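{- Let $\Pi\le\Gamma$ be a subgroup of order $2$ that fixes $S$ setwise, let $\Delta$ be the restriction of $\Pi$ to $R\cup C$, let $\mathcal{F}$ be a one-factorization of $K_{n,n}$ with $\Delta\le\Phi_{\mathcal{F}}$, and let $f:S\to\mathcal{F}$ be a bijection. Then $(\mathcal{F},f)$ agrees with $\Pi$ if and only if the Latin square $\mathcal{L}=\{\{r,c,s\}: s\in S,\ \{r,c\}\in f(s)\}$ satisfies $\Pi\le\Gamma_{\mathcal{L}}$.
   Context: $R,C,S$ are pairwise disjoint $n$-element sets; a Latin square is a set of triples, each with one point from each of $R,C,S$, such that any two points from different classes lie in exactly one triple. $\Gamma$ is the group of permutations of $R\cup C\cup S$ preserving the partition $\{R,C,S\}$, and $\Gamma_{\mathcal{L}}$ is the stabilizer of $\mathcal{L}$ in $\Gamma$. $K_{n,n}$ is the complete bipartite graph on $R\cup C$ with bipartition $\{R,C\}$; $\Phi$ is the group of permutations of $R\cup C$ preserving the partition $\{R,C\}$, acting on spanning subgraphs and on one-factorizations (sets of one-factors partitioning the edges) via the vertices; $\Phi_{\mathcal{F}}$ is the stabilizer of $\mathcal{F}$. For $\delta\in\Delta$ let $\bar\delta$ be the permutation of $R\cup C\cup\mathcal{F}$ (treated as disjoint sets) induced by $\delta$ on $R\cup C$ and on $\mathcal{F}$, and $\bar\Delta=\{\bar\delta:\delta\in\Delta\}$. Let $\bar f:R\cup C\cup S\to R\cup C\cup\mathcal{F}$ extend $f$ by the identity on $R\cup C$. The pair $(\mathcal{F},f)$ agrees with $\Pi$ if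 $\{\bar f^{ -1}\bar\delta\bar f:\delta\in\Delta\}=\Pi$. -}

module Defs where

open import Data.Nat using (ℕ)
open import Data.Fin using (Fin)
open import Data.Bool using (Bool; true; false)
open import Data.List using (List; []; _∷_; map)
open import Data.Product using (_×_; _,_; ∃; Σ)
open import Data.Sum using (_⊎_)
open import Data.Empty using (⊥)
open import Relation.Binary.PropositionalEquality using (_≡_)
open import Relation.Nullary using (¬_)
open import Function.Bundles using (_↔_; Inverse; _⇔_)
open import Data.List.Relation.Binary.Permutation.Propositional using (_↭_)

-- Points.  R, C, S are modelled as three tagged copies of Fin n.

data Cls : Set where
  cR cC cS : Cls

Pt : ℕ → Set
Pt n = Cls × Fin n

cls : ∀ {n} → Pt n → Cls
cls (k , _) = k

data Side : Set where
  sR sC : Side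

-- R ∪ C : the vertex set of K_{n,n}
V : ℕ → Set
V n = Side × Fin n

side : ∀ {n} → V n → Side
side (k , _) = k

embed : ∀ {n} → V n → Pt n
embed (sR , i) = (cR , i)
embed (sC , i) = (cC , i)

-- Γ : permutations of R ∪ C ∪ S preserving the partition {R, C, S}
-- (two points lie in the same class iff their images do).

InΓ : ∀ {n} → (Pt n → Pt n) → Set
InΓ g = ∀ x y → (cls x ≡ cls y) ⇔ (cls (g x) ≡ cls (g y))

-- Φ : permutations of R ∪ C preserving the partition {R, C}.
InΦ : ∀ {n} → (V n → V n) → Set
InΦ d = ∀ u v → (side u ≡ side v) ⇔ (side (d u) ≡ side (d v))

-- The subgroup Π = {id, π} of order 2 generated by the involution π.
-- Membership of a map g (up to pointwise equality).

InΠ : ∀ {n} → (Pt n ↔ Pt n) → (Pt n → Pt n) → Set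
InΠ π g = (∀ x → g x ≡ x) ⊎ (∀ x → g x ≡ Inverse.to π x)

IsOrderTwo : ∀ {n} → (Pt n ↔ Pt n) → Set
IsOrderTwo π = (∀ x → Inverse.to π (Inverse.to π x) ≡ x)
             × ∃ (λ x → ¬ (Inverse.to π x ≡ x))

FixesS : ∀ {n} → (Pt n ↔ Pt n) → Set
FixesS π = ∀ x → (cls x ≡ cS) ⇔ (cls (Inverse.to π x) ≡ cS)

InΔ : ∀ {n} → (Pt n ↔ Pt n) → (V n ↔ V n) → Set
InΔ π d = ∃ λ g → InΠ π g × (∀ v → embed (Inverse.to d v) ≡ g (embed v))

-- Spanning subgraphs of K_{n,n}: M r c = true iff {r, c} is an edge.

EdgeSet : ℕ → Set
EdgeSet n = Fin n → Fin n → Bool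

_≐_ : ∀ {n} → EdgeSet n → EdgeSet n → Set
M ≐ N = ∀ r c → M r c ≡ N r c

adj : ∀ {n} → EdgeSet n → V n → V n → Bool
adj M (sR , r) (sC , c) = M r c
adj M (sC , c) (sR , r) = M r c
adj M (sR , _) (sR , _) = false
adj M (sC , _) (sC , _) = false

-- action of a permutation d of R ∪ C on subgraphs: {u,v} ↦ {d u, d v}
act : ∀ {n} → (V n ↔ V n) → EdgeSet n → EdgeSet n
act d M r c = adj M (Inverse.from d (sR , r)) (Inverse.from d (sC , c))

OneFactor : ∀ {n} → EdgeSet n → Set
OneFactor {n} M =
    (∀ r → ∃ λ c → M r c ≡ true × (∀ c' → M r c' ≡ true → c' ≡ c))
  × (∀ c → ∃ λ r → M r c ≡ true × (∀ r' → M r' c ≡ true → r' ≡ r))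

-- A one-factorization, given as a set P of edge sets (closed under ≐):
-- its members are one-factors and they partition the edges of K_{n,n}.
OneFactorization : ∀ {n} → (EdgeSet n → Set) → Set
OneFactorization {n} P =
    (∀ M N → M ≐ N → P M → P N)
  × (∀ M → P M → OneFactor M)
  × (∀ r c → ∃ λ M → P M × M r c ≡ true)
  × (∀ r c M N → P M → P N → M r c ≡ true → N r c ≡ true → M ≐ N)

StabF : ∀ {n} → (EdgeSet n → Set) → (V n ↔ V n) → Set
StabF P d = (∀ M → P M → P (act d M))
          × (∀ N → P N → ∃ λ M → P M × act d M ≐ N)

BijOnto : ∀ {n} → (EdgeSet n → Set) → (Fin n → EdgeSet n) → Set
BijOnto P f = (∀ s → P (f s))
            × (∀ s s' → f s ≐ f s' → s ≡ s')
            × (∀ M → P M → ∃ λ s → f s ≐ M)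

-- g equals  f̄⁻¹ δ̄ f̄  (as a map R ∪ C ∪ S → R ∪ C ∪ S)

IsConj : ∀ {n} → (Fin n → EdgeSet n) → (V n ↔ V n) → (Pt n → Pt n) → Set
IsConj f d g = (∀ v → g (embed v) ≡ embed (Inverse.to d v))
             × (∀ s → ∃ λ s' → g (cS , s) ≡ (cS , s') × f s' ≐ act d (f s))

-- (F, f) agrees with Π :  { f̄⁻¹ δ̄ f̄ : δ ∈ Δ } = Π
Agrees : ∀ {n} → (Pt n ↔ Pt n) → (Fin n → EdgeSet n) → Set
Agrees π f = ∀ g → (∃ λ d → InΔ π d × IsConj f d g) ⇔ InΠ π g

-- The Latin square L = {{r,c,s} : {r,c} ∈ f(s)}; a triple is given as a
-- list of points, compared as a set via permutation.

InL : ∀ {n} → (Fin n → EdgeSet n) → List (Pt n) → Set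
InL {n} f T = ∃ λ (r : Fin n) → ∃ λ (c : Fin n) → ∃ λ (s : Fin n) →
  f s r c ≡ true × T ↭ ((cR , r) ∷ (cC , c) ∷ (cS , s) ∷ [])

StabL : ∀ {n} → (Fin n → EdgeSet n) → (Pt n → Pt n) → Set
StabL f g = (∀ T → InL f T → InL f (map g T))
          × (∀ T → InL f T → ∃ λ T₀ → InL f T₀ × map g T₀ ↭ T)

ΠStabL : ∀ {n} → (Pt n ↔ Pt n) → (Fin n → EdgeSet n) → Set
ΠStabL π f = ∀ g → InΠ π g → StabL f g

-- Write g ~ δ ("g is f̄⁻¹ δ̄ f̄") when g agrees with δ on R ∪ C and sends
-- each s ∈ S to the s' with f(s') = δ(f(s)).  The proof rests on two facts
-- about a fixed δ ∈ Φ with δ(F) = F: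
--   (1) if g ~ δ then g maps every triple of L to a triple of L, because
--       δ sends the edge {r,c} of f(s) to an edge of δ(f(s)) = f(s');
--   (2) conversely, a map h preserving S that agrees with δ on R ∪ C and
--       maps L into L satisfies h ~ δ: h sends the triple {r,c,s} to
--       {δr, δc, h s} ∈ L, so f(h s) and δ(f(s)) share the edge {δr, δc},
--       and one-factors of F sharing an edge coincide.
-- Since f is injective, the relation g ~ δ determines g.  Every g ∈ Π is an
-- involution preserving S, so it restricts to some δ ∈ Δ.  Then:
--   agrees ⇒ stabilizes: g ∈ Π has some g ~ δ, so (1) applies, and an
--     involution mapping L into L maps L onto L;
--   stabilizes ⇒ agrees: g ∈ Π satisfies g ~ (its restriction) by (2); and if
--     g ~ δ with δ the restriction of g₀ ∈ Π, then also g₀ ~ δ by (2), so g = g₀.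
module Submission where

open import Defs
open import Data.Nat using (ℕ)
open import Data.Fin using (Fin)
open import Data.Product using (_×_; _,_; proj₁; proj₂; ∃; ∃₂)
open import Data.Sum using (inj₁; inj₂)
open import Data.Empty using (⊥-elim)
open import Data.Bool using (true)
open import Data.List using (List; []; _∷_; map)
open import Data.List.Properties using (map-∘; map-cong; map-id)
open import Data.List.Relation.Unary.Any using (here; there)
open import Data.List.Membership.Propositional using (_∈_)
open import Data.List.Relation.Binary.Permutation.Propositional
  using (_↭_; ↭-refl; ↭-sym; ↭-trans; ↭-reflexive; swap)
open import Data.List.Relation.Binary.Permutation.Propositional.Properties
  using (∈-resp-↭; map⁺)
open import Relation.Binary.PropositionalEquality
open import Relation.Nullary using (¬_)
open import Function.Base using (id)
open import Function.Bundles using (_↔_; Inverse; _⇔_; mk⇔; Equivalence; mk↔ₛ′)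
import Function.Properties.Equivalence as ⇔

module _ {n : ℕ} where

  triple : Fin n → Fin n → Fin n → List (Pt n)
  triple r c s = (cR , r) ∷ (cC , c) ∷ (cS , s) ∷ []

  triple-injective : ∀ {r c s r' c' s'} → triple r c s ↭ triple r' c' s'
    → r ≡ r' × c ≡ c' × s ≡ s'
  triple-injective p =
      row (∈-resp-↭ p (here refl))
    , col (∈-resp-↭ p (there (here refl)))
    , symbol (∈-resp-↭ p (there (there (here refl))))
    where
    row : ∀ {r r' c' s'} → (cR , r) ∈ triple r' c' s' → r ≡ r'
    row (here refl) = refl
    row (there (here ()))
    row (there (there (here ())))
    col : ∀ {c r' c' s'} → (cC , c) ∈ triple r' c' s' → c ≡ c'
    col (here ())
    col (there (here refl)) = refl
    col (there (there (here ())))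
    symbol : ∀ {s r' c' s'} → (cS , s) ∈ triple r' c' s' → s ≡ s'
    symbol (here ())
    symbol (there (here ()))
    symbol (there (there (here refl))) = refl

  embed-injective : ∀ {u v : V n} → embed u ≡ embed v → u ≡ v
  embed-injective {sR , _} {sR , _} refl = refl
  embed-injective {sC , _} {sC , _} refl = refl
  embed-injective {sR , _} {sC , _} ()
  embed-injective {sC , _} {sR , _} ()

  embed-not-S : ∀ (v : V n) → ¬ (cls (embed v) ≡ cS)
  embed-not-S (sR , _) ()
  embed-not-S (sC , _) ()

  toV : (x : Pt n) → ¬ (cls x ≡ cS) → V n
  toV (cR , i) _ = (sR , i)
  toV (cC , i) _ = (sC , i)
  toV (cS , _) notS = ⊥-elim (notS refl)

  embed-toV : ∀ x (notS : ¬ (cls x ≡ cS)) → embed (toV x notS) ≡ x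
  embed-toV (cR , _) _ = refl
  embed-toV (cC , _) _ = refl
  embed-toV (cS , _) notS = ⊥-elim (notS refl)

  in-S : ∀ (x : Pt n) → cls x ≡ cS → ∃ λ t → x ≡ (cS , t)
  in-S (cS , t) refl = t , refl

  Extends : (V n ↔ V n) → (Pt n → Pt n) → Set
  Extends d h = ∀ v → h (embed v) ≡ embed (Inverse.to d v)

  from-of-to : (d : V n ↔ V n) → ∀ {u v} → Inverse.to d u ≡ v → Inverse.from d v ≡ u
  from-of-to d eq = Inverse.inverseʳ d (sym eq)

  Φ-separates : (d : V n ↔ V n) → InΦ (Inverse.to d) → ∀ r c →
    ¬ (side (Inverse.to d (sR , r)) ≡ side (Inverse.to d (sC , c)))
  Φ-separates d dΦ r c same with Equivalence.from (dΦ (sR , r) (sC , c)) same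
  ... | ()

  edge-image : (d : V n ↔ V n) → InΦ (Inverse.to d) → (M : EdgeSet n)
    → ∀ {r c} → M r c ≡ true
    → ∃₂ λ r' c' → act d M r' c' ≡ true
        × (∀ x → embed (Inverse.to d (sR , r)) ∷ embed (Inverse.to d (sC , c)) ∷ x ∷ []
                   ↭ (cR , r') ∷ (cC , c') ∷ x ∷ [])
  edge-image d dΦ M {r} {c} e
    with Inverse.to d (sR , r) in dr | Inverse.to d (sC , c) in dc
  ... | sR , a | sC , b =
    a , b , subst₂ (λ u v → adj M u v ≡ true)
                   (sym (from-of-to d dr)) (sym (from-of-to d dc)) e
      , λ _ → ↭-refl
  ... | sC , b | sR , a =
    a , b , subst₂ (λ u v → adj M u v ≡ true)
                   (sym (from-of-to d dc)) (sym (from-of-to d dr)) e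
      , λ _ → swap _ _ ↭-refl
  ... | sR , _ | sR , _ =
    ⊥-elim (Φ-separates d dΦ r c (trans (cong side dr) (sym (cong side dc))))
  ... | sC , _ | sC , _ =
    ⊥-elim (Φ-separates d dΦ r c (trans (cong side dr) (sym (cong side dc))))

  triple-image : (d : V n ↔ V n) → InΦ (Inverse.to d) → (h : Pt n → Pt n)
    → Extends d h → (M : EdgeSet n) → ∀ {r c s t} → M r c ≡ true
    → h (cS , s) ≡ (cS , t)
    → ∃₂ λ r' c' → act d M r' c' ≡ true × map h (triple r c s) ↭ triple r' c' t
  triple-image d dΦ h hd M {r} {c} e hs with edge-image d dΦ M e
  ... | r' , c' , e' , img =
    r' , c' , e' ,
    ↭-trans (↭-reflexive (cong₂ _∷_ (hd (sR , r)) (cong₂ _∷_ (hd (sC , c)) (cong (_∷ []) hs))))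
            (img _)

  conj-maps-L : (f : Fin n → EdgeSet n) (d : V n ↔ V n) → InΦ (Inverse.to d)
    → (g : Pt n → Pt n) → IsConj f d g → ∀ T → InL f T → InL f (map g T)
  conj-maps-L f d dΦ g (gd , gS) T (r , c , s , e , T↭) with gS s
  ... | s' , gs , fs'≐ with triple-image d dΦ g gd (f s) e gs
  ... | r' , c' , e' , img = r' , c' , s' , trans (fs'≐ r' c') e' , ↭-trans (map⁺ g T↭) img

  involution-stabilizes-L : (f : Fin n → EdgeSet n) (g : Pt n → Pt n)
    → (∀ x → g (g x) ≡ x) → (∀ T → InL f T → InL f (map g T)) → StabL f g
  involution-stabilizes-L f g g-inv into =
    into , λ T T∈L → map g T , into T T∈L , ↭-reflexive (twice T)
    where
    open ≡-Reasoning
    twice : ∀ T → map g (map g T) ≡ T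
    twice T = begin
      map g (map g T)       ≡⟨ map-∘ T ⟨
      map (λ x → g (g x)) T ≡⟨ map-cong g-inv T ⟩
      map id T              ≡⟨ map-id T ⟩
      T                     ∎

  -- Fact (2): let δ ∈ Φ map the one-factors f(s) into the one-factorization P.
  -- A map h preserving S, extending δ and mapping L into L is f̄⁻¹ δ̄ f̄.
  -- (Any edge of f(s) serves as the shared edge; we take the one in row s.)
  L-preserving-is-conj : (P : EdgeSet n → Set) → OneFactorization P
    → (f : Fin n → EdgeSet n) → (∀ s → P (f s))
    → (d : V n ↔ V n) → InΦ (Inverse.to d) → (∀ s → P (act d (f s)))
    → (h : Pt n → Pt n) → Extends d h → (∀ s → ∃ λ t → h (cS , s) ≡ (cS , t))
    → (∀ T → InL f T → InL f (map h T)) → IsConj f d h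
  L-preserving-is-conj P (_ , oneFactor , _ , shared-edge) f fP d dΦ dfP h hd hS into =
    hd , image-factor
    where
    image-factor : ∀ s → ∃ λ t → h (cS , s) ≡ (cS , t) × f t ≐ act d (f s)
    image-factor s with hS s | proj₁ (oneFactor (f s) (fP s)) s
    ... | t , hs | c , e , _ with into _ (s , c , s , e , ↭-refl)
    ... | r'' , c'' , s'' , e'' , h-img with triple-image d dΦ h hd (f s) e hs
    ... | r' , c' , e' , img with triple-injective (↭-trans (↭-sym h-img) img)
    ... | refl , refl , refl = t , hs , shared-edge r' c' (f t) (act d (f s)) (fP t) (dfP s) e'' e'

  conj-unique : (f : Fin n → EdgeSet n) → (∀ s s' → f s ≐ f s' → s ≡ s')
    → (d : V n ↔ V n) (g h : Pt n → Pt n) → IsConj f d g → IsConj f d h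
    → ∀ x → g x ≡ h x
  conj-unique f f-inj d g h (gd , _) (hd , _) (cR , j) = trans (gd (sR , j)) (sym (hd (sR , j)))
  conj-unique f f-inj d g h (gd , _) (hd , _) (cC , j) = trans (gd (sC , j)) (sym (hd (sC , j)))
  conj-unique f f-inj d g h (_ , gS) (_ , hS) (cS , s) with gS s | hS s
  ... | s' , gs , fs'≐ | s'' , hs , fs''≐ =
    trans gs (trans (cong (cS ,_) (f-inj s' s'' (λ r c → trans (fs'≐ r c) (sym (fs''≐ r c)))))
                    (sym hs))

  PreservesS : (Pt n → Pt n) → Set
  PreservesS g = ∀ x → (cls x ≡ cS) ⇔ (cls (g x) ≡ cS)

  S-to-S : ∀ g → PreservesS g → ∀ s → ∃ λ t → g (cS , s) ≡ (cS , t)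
  S-to-S g gS s = in-S (g (cS , s)) (Equivalence.to (gS (cS , s)) refl)

  restrict : (g : Pt n → Pt n) → PreservesS g → V n → V n
  restrict g gS v = toV (g (embed v)) (λ inS → embed-not-S v (Equivalence.from (gS (embed v)) inS))

  restrict-extends : (g : Pt n → Pt n) (gS : PreservesS g)
    → ∀ v → embed (restrict g gS v) ≡ g (embed v)
  restrict-extends g gS v = embed-toV (g (embed v)) _

  restriction : (g : Pt n → Pt n) → PreservesS g → (∀ x → g (g x) ≡ x) → V n ↔ V n
  restriction g gS g-inv = mk↔ₛ′ δ δ δ-inv δ-inv
    where
    δ = restrict g gS
    δ-inv : ∀ v → δ (δ v) ≡ v
    δ-inv v = embed-injective (begin
      embed (δ (δ v))     ≡⟨ restrict-extends g gS (δ v) ⟩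
      g (embed (δ v))     ≡⟨ cong g (restrict-extends g gS v) ⟩
      g (g (embed v))     ≡⟨ g-inv (embed v) ⟩
      embed v             ∎)
      where open ≡-Reasoning

  module _ (π : Pt n ↔ Pt n) where

    Π-involutive : (∀ x → Inverse.to π (Inverse.to π x) ≡ x)
      → ∀ {g} → InΠ π g → ∀ x → g (g x) ≡ x
    Π-involutive _ (inj₁ g-id) x = trans (g-id _) (g-id x)
    Π-involutive π-inv (inj₂ g-π) x =
      trans (g-π _) (trans (cong (Inverse.to π) (g-π x)) (π-inv x))

    Π-preserves-S : FixesS π → ∀ {g} → InΠ π g → PreservesS g
    Π-preserves-S _ (inj₁ g-id) x =
      subst (λ y → (cls x ≡ cS) ⇔ (cls y ≡ cS)) (sym (g-id x)) ⇔.refl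
    Π-preserves-S π-S (inj₂ g-π) x =
      subst (λ y → (cls x ≡ cS) ⇔ (cls y ≡ cS)) (sym (g-π x)) (π-S x)

    Π-resp-≗ : ∀ {g h} → (∀ x → g x ≡ h x) → InΠ π h → InΠ π g
    Π-resp-≗ g≗h (inj₁ h-id) = inj₁ λ x → trans (g≗h x) (h-id x)
    Π-resp-≗ g≗h (inj₂ h-π) = inj₂ λ x → trans (g≗h x) (h-π x)

lemma4p2 : ∀ {n : ℕ} (π : Pt n ↔ Pt n)
    → InΓ (Inverse.to π) → IsOrderTwo π → FixesS π
    → (P : EdgeSet n → Set) → OneFactorization P
    → (∀ d → InΔ π d → InΦ (Inverse.to d) × StabF P d)
    → (f : Fin n → EdgeSet n) → BijOnto P f
    → Agrees π f ⇔ ΠStabL π f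
lemma4p2 π _ (π-inv , _) π-S P P-1F Δ⊆Φ_F f (fP , f-inj , _) = mk⇔ agrees⇒stab stab⇒agrees
  where
  agrees⇒stab : Agrees π f → ΠStabL π f
  agrees⇒stab agrees g g∈Π with Equivalence.from (agrees g) g∈Π
  ... | d , d∈Δ , g-conj =
    involution-stabilizes-L f g (Π-involutive π π-inv g∈Π)
      (conj-maps-L f d (proj₁ (Δ⊆Φ_F d d∈Δ)) g g-conj)

  stab⇒agrees : ΠStabL π f → Agrees π f
  stab⇒agrees stab g = mk⇔ conj⇒Π Π⇒conj
    where
    member-is-conj : ∀ h → InΠ π h → ∀ d → InΔ π d → Extends d h → IsConj f d h
    member-is-conj h h∈Π d d∈Δ hd =
      L-preserving-is-conj P P-1F f fP d (proj₁ (Δ⊆Φ_F d d∈Δ))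
        (λ s → proj₁ (proj₂ (Δ⊆Φ_F d d∈Δ)) (f s) (fP s))
        h hd (S-to-S h (Π-preserves-S π π-S h∈Π)) (proj₁ (stab h h∈Π))

    conj⇒Π : (∃ λ d → InΔ π d × IsConj f d g) → InΠ π g
    conj⇒Π (d , d∈Δ@(g₀ , g₀∈Π , g₀-extends) , g-conj) =
      Π-resp-≗ π (conj-unique f f-inj d g g₀ g-conj
                    (member-is-conj g₀ g₀∈Π d d∈Δ (λ v → sym (g₀-extends v))))
               g₀∈Π

    Π⇒conj : InΠ π g → ∃ λ d → InΔ π d × IsConj f d g
    Π⇒conj g∈Π = δ , δ∈Δ , member-is-conj g g∈Π δ δ∈Δ (λ v → sym (restrict-extends g g-S v))
      where
      g-S = Π-preserves-S π π-S g∈Π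
      δ = restriction g g-S (Π-involutive π π-inv g∈Π)
      δ∈Δ : InΔ π δ
      δ∈Δ = g , g∈Π , restrict-extends g g-S
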